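{- Let $\delta>0$. There is $n_0$ such that the following holds. Let $\mathcal A$ be a reduced hypergraph with index set $I$, let $K,L,M\subseteq I$ be pairwise disjoint sets each of size at least $n_0$, and let $\mathcal Q(K,L),\mathcal R(K,M),\mathcal S(L,M)$ be an inhabited triple of transversals. If both pairs $\mathcal Q(K,L)\mathcal R(K,M)$ and $\mathcal Q(K,L)\mathcal S(L,M)$ have $\delta$-intersecting links, then $\mathcal A$ supports a $K_5^{(3)}$.
   Context: A reduced hypergraph $\mathcal A$ with index set $I$ (a finite subset of $\mathbb N$) is given by pairwise disjoint nonempty finite sets $\mathcal P^{ij}$, one for each $ij\in I^{(2)}$, and for each $ijk\in I^{(3)}$ a 3-partite 3-uniform hypergraph $\mathcal A^{ijk}$ with vertex classes $\mathcal P^{ij},\mathcal P^{ik},\mathcal P^{jk}$; $E(\mathcal A)=\bigcup E(\mathcal A^{ijk})$; $X^{(k)}$ is the set of $k$-subsets of $X$. For distinct $i,j,k$, $P\in\mathcal P^{ij}$, $P'\in\mathcal P^{ik}$ let $N(P,P')=\{P''\in\mathcal P^{jk}:PP'P''\in E(\mathcal A)\}$. $\mathcal A$ supports $K_5^{(3)}$ if there are a 5-set $J\subseteq I$ and $P^{ij}\in\mathcal P^{ij}$ ($ij\in J^{(2)}$) with $P^{ij}P^{ik}P^{jk}\in E(\mathcal A^{ijk})$ for all $ijk\in J^{(3)}$. For disjoint $A,B\subseteq I$, an $(A,B)$-transversal is a choice $\mathcal X=\{X^{ab}\in\mathcal P^{ab}:(a,b)\in A\times B\}$. The triple $\mathcal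 Q(K,L),\mathcal R(K,M),\mathcal S(L,M)$ is inhabited if $Q^{k\ell}R^{km}S^{\ell m}\in E(\mathcal A)$ for all $k\in K,\ell\in L,m\in M$. For pairwise disjoint $A,B,C$ and transversals $\mathcal X(A,B)$, $\mathcal Y(A,C)$ (sharing the index set $A$), the pair has $\delta$-intersecting links if $|N(X^{ab},X^{a'b})\cap N(Y^{ac},Y^{a'c})|\ge\delta|\mathcal P^{aa'}|$ for all $b\in B$, $c\in C$, $aa'\in A^{(2)}$. Thus $\mathcal Q(K,L)\mathcal R(K,M)$ is compared on $\mathcal P^{kk'}$ via $N(Q^{k\ell},Q^{k'\ell})\cap N(R^{km},R^{k'm})$, and $\mathcal Q(K,L)\mathcal S(L,M)$ on $\mathcal P^{\ell\ell'}$ via $N(Q^{k\ell},Q^{k\ell'})\cap N(S^{\ell m},S^{\ell'm})$.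
   Formalization: The parameter δ ranges over the positive rationals. -}

module Defs where

open import Data.Nat using (ℕ; _≤_)
open import Data.Bool using (Bool; true; _∧_)
open import Data.List using (List; []; length; filter)
open import Data.List.Membership.Propositional using (_∈_)
open import Data.List.Relation.Unary.Unique.Propositional using (Unique)
open import Data.List.Relation.Unary.All using (All)
open import Data.Product using (_×_; Σ; ∃; ∃-syntax)
open import Data.Sum using (_⊎_)
open import Relation.Binary.PropositionalEquality using (_≡_; _≢_)
open import Relation.Nullary using (¬_)
open import Data.Bool.Properties using (T?)
open import Data.Bool using (T)
open import Data.Integer using (+_)
open import Data.Rational as ℚ using (ℚ)

-- Vertices (the elements P of the classes 𝒫^{ij}) are natural numbers.
record ReducedHypergraph : Set where
  field
    I        : List ℕ
    I-unique : Unique I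
    P        : ℕ → ℕ → List ℕ
    P-sym    : ∀ i j → P i j ≡ P j i
    P-unique : ∀ i j → Unique (P i j)
    P-nonempty : ∀ i j → i ∈ I → j ∈ I → i ≢ j → P i j ≢ []
    P-disjoint : ∀ i j k l x → i ∈ I → j ∈ I → k ∈ I → l ∈ I → i ≢ j → k ≢ l →
                 x ∈ P i j → x ∈ P k l → (i ≡ k × j ≡ l) ⊎ (i ≡ l × j ≡ k)
    edge     : ℕ → ℕ → ℕ → Bool
    edge-sym₁ : ∀ x y z → edge x y z ≡ edge y x z
    edge-sym₂ : ∀ x y z → edge x y z ≡ edge x z y
    edge-wf  : ∀ x y z → edge x y z ≡ true →
               Σ ℕ λ i → Σ ℕ λ j → Σ ℕ λ k →
                 i ∈ I × j ∈ I × k ∈ I × i ≢ j × i ≢ k × j ≢ k ×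
                 x ∈ P i j × y ∈ P i k × z ∈ P j k

module _ (𝒜 : ReducedHypergraph) where
  open ReducedHypergraph 𝒜

  SubsetOfI : List ℕ → Set
  SubsetOfI A = Unique A × All (_∈ I) A

  Disjoint : List ℕ → List ℕ → Set
  Disjoint A B = ∀ x → x ∈ A → x ∈ B → ⊥'
    where open import Data.Empty renaming (⊥ to ⊥')

  SupportsK5 : Set
  SupportsK5 =
    Σ (List ℕ) λ J → SubsetOfI J × length J ≡ 5 ×
    Σ (ℕ → ℕ → ℕ) λ Pc →
      (∀ i j → i ∈ J → j ∈ J → i ≢ j → Pc i j ≡ Pc j i) ×
      (∀ i j → i ∈ J → j ∈ J → i ≢ j → Pc i j ∈ P i j) ×
      (∀ i j k → i ∈ J → j ∈ J → k ∈ J → i ≢ j → i ≢ k → j ≢ k →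
         edge (Pc i j) (Pc i k) (Pc j k) ≡ true)

  IsTransversal : List ℕ → List ℕ → (ℕ → ℕ → ℕ) → Set
  IsTransversal A B X = ∀ a b → a ∈ A → b ∈ B → X a b ∈ P a b

  Inhabited : List ℕ → List ℕ → List ℕ → (Q R S : ℕ → ℕ → ℕ) → Set
  Inhabited K L M Q R S = ∀ k ℓ m → k ∈ K → ℓ ∈ L → m ∈ M →
    edge (Q k ℓ) (R k m) (S ℓ m) ≡ true

  NCap : ℕ → ℕ → ℕ → ℕ → ℕ → ℕ → List ℕ
  NCap a a' x y x' y' = filter (λ z → T? (edge x y z ∧ edge x' y' z)) (P a a')

  IntersectingLinks : ℚ → List ℕ → List ℕ → List ℕ → (X Y : ℕ → ℕ → ℕ) → Set
  IntersectingLinks δ A B C X Y = ∀ b c a a' → b ∈ B → c ∈ C → a ∈ A → a' ∈ A → a ≢ a' →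
    δ ℚ.* ((+ length (P a a')) ℚ./ 1)
      ℚ.≤ ((+ length (NCap a a' (X a b) (X a' b) (Y a c) (Y a' c))) ℚ./ 1)

-- Write δ ≥ 1/d with d the denominator of δ, fix m ∈ M and a set K' of d + 1 indices of K.
-- For ℓ ≠ ℓ' in L the d + 1 sets N(Q^{kℓ},Q^{kℓ'}) ∩ N(S^{ℓm},S^{ℓ'm}) ⊆ 𝒫^{ℓℓ'} (k ∈ K')
-- each contain at least a 1/d fraction of 𝒫^{ℓℓ'}, so two of them, for some k ≠ k', meet;
-- colour ℓℓ' by such a pair kk'. Multicolour Ramsey yields d + 1 indices W ⊆ L all of whose
-- pairs have the same colour kk'. The same counting in 𝒫^{kk'} for the sets
-- N(Q^{kℓ},Q^{k'ℓ}) ∩ N(R^{km},R^{k'm}) (ℓ ∈ W) gives ℓ ≠ ℓ' in W and a common vertex X, and the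
-- colour of ℓℓ' gives a vertex Y of 𝒫^{ℓℓ'}. Then X, Y and the transversal vertices on
-- {k, k', ℓ, ℓ', m} span a K₅^{(3)}.

module Submission where

open import Defs
open import Data.Bool using (Bool; true; false; T; _∧_; _∨_)
open import Data.Bool.ListAction using (any)
open import Data.Bool.Properties using (T-∧)
open import Data.Empty using (⊥-elim)
import Data.Integer as ℤ
import Data.Integer.Properties as ℤ
open import Data.List using (List; []; _∷_; length; map; _++_; filter; filterᵇ; findᵇ; take)
open import Data.List.Properties using (length-map; length-filter; length-++; length-take)
open import Data.List.Membership.Propositional using (_∈_; find; lose)
open import Data.List.Membership.Propositional.Properties using (∈-map⁺; ∈-map⁻; ∈-++⁺ˡ; ∈-++⁺ʳ; ∈-++⁻)
open import Data.List.Relation.Unary.All as All using (All; []; _∷_)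
open import Data.List.Relation.Unary.All.Properties as All using (all-filter)
open import Data.List.Relation.Unary.Any using (Any; here; there; any?)
open import Data.List.Relation.Unary.Any.Properties using (any⁺; any⁻)
open import Data.List.Relation.Unary.AllPairs using (AllPairs; []; _∷_)
import Data.List.Relation.Unary.AllPairs.Properties as AllPairs
open import Data.List.Relation.Unary.Unique.Propositional using (Unique)
open import Data.List.Relation.Binary.Sublist.Propositional using (_⊆_; []; _∷_; _∷ʳ_; ⊆-trans; minimum)
open import Data.List.Relation.Binary.Sublist.Propositional.Properties as Sublist
  using (filter-⊆; take-⊆; All-resp-⊆; Any-resp-⊆)
open import Data.Maybe using (fromMaybe)
open import Data.Nat using (ℕ; zero; suc; _+_; _*_; _≤_; _<_; _⊓_; _⊔_; _≟_; _<?_; z≤n; z<s; >-nonZero)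
open import Data.Nat.Combinatorics using (_C_; nC1≡n; nCk+nC[k+1]≡[n+1]C[k+1])
open import Data.Nat.ListAction using (sum)
open import Data.Nat.Properties
open import Data.Product using (Σ; _×_; _,_; proj₁; proj₂; ∃-syntax)
open import Data.Product.Properties using (≡-dec)
open import Data.Rational as ℚ using (ℚ; mkℚ; Positive; toℚᵘ; ↧ₙ_)
import Data.Rational.Properties as ℚ
open import Data.Rational.Unnormalised as ℚᵘ using (mkℚᵘ; *≤*)
import Data.Rational.Unnormalised.Properties as ℚᵘ
open import Data.Sum using (_⊎_; inj₁; inj₂)
open import Data.Unit using (⊤; tt)
open import Function using (_∘_; Equivalence)
open import Relation.Binary.Definitions using (DecidableEquality)
open import Relation.Binary.PropositionalEquality hiding (J)
open import Relation.Nullary using (¬_; yes; no; does)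
open import Relation.Nullary.Decidable using (T?)
open import Relation.Unary using (Decidable)
open import Relation.Unary.Properties using (∁?)

private variable
  A B : Set
  x y z : A
  xs ys : List A

T-∧⇒≡true : ∀ {a b} → T (a ∧ b) → a ≡ true × b ≡ true
T-∧⇒≡true {true} {true} _ = refl , refl

≢[]⇒0<length : xs ≢ [] → 0 < length xs
≢[]⇒0<length {xs = []}    xs≢[] = ⊥-elim (xs≢[] refl)
≢[]⇒0<length {xs = _ ∷ _} _     = z<s

0<length⇒∈ : 0 < length xs → ∃[ x ] x ∈ xs
0<length⇒∈ {xs = x ∷ _} _ = x , here refl

count : (A → Bool) → List A → ℕ
count p = length ∘ filterᵇ p

count-∨ : (f g : A → Bool) (zs : List A) → ¬ Any (λ z → T (f z ∧ g z)) zs →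
          count (λ z → f z ∨ g z) zs ≡ count f zs + count g zs
count-∨ f g [] _ = refl
count-∨ f g (z ∷ zs) disjoint with f z in fz | g z in gz
... | true  | true  = ⊥-elim (disjoint (here (subst T (sym (cong₂ _∧_ fz gz)) _)))
... | true  | false = cong suc (count-∨ f g zs (disjoint ∘ there))
... | false | true  = trans (cong suc (count-∨ f g zs (disjoint ∘ there)))
                           (sym (+-suc (count f zs) (count g zs)))
... | false | false = count-∨ f g zs (disjoint ∘ there)

module _ {P : A → Set} (P? : Decidable P) where

  length-filter-∁ : ∀ xs → length (filter P? xs) + length (filter (∁? P?) xs) ≡ length xs
  length-filter-∁ [] = refl
  length-filter-∁ (x ∷ xs) with does (P? x)
  ... | true  = cong suc (length-filter-∁ xs)
  ... | false = trans (+-suc _ _) (cong suc (length-filter-∁ xs))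

AllPairs-resp-⊆ : {R : A → A → Set} → xs ⊆ ys → AllPairs R ys → AllPairs R xs
AllPairs-resp-⊆ []        []         = []
AllPairs-resp-⊆ (y ∷ʳ τ)  (_ ∷ rys)  = AllPairs-resp-⊆ τ rys
AllPairs-resp-⊆ (refl ∷ τ) (ry ∷ rys) = All-resp-⊆ τ ry ∷ AllPairs-resp-⊆ τ rys

allPairs-lookup : {R : A → A → Set} → (∀ {x y} → R x y → R y x) →
                  AllPairs R xs → x ∈ xs → y ∈ xs → x ≢ y → R x y
allPairs-lookup R-sym (_ ∷ _)    (here refl) (here refl) x≢y = ⊥-elim (x≢y refl)
allPairs-lookup R-sym (rx ∷ _)   (here refl) (there y∈) _    = All.lookup rx y∈
allPairs-lookup R-sym (ry ∷ _)   (there x∈) (here refl) _    = R-sym (All.lookup ry x∈)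
allPairs-lookup R-sym (_ ∷ rxs)  (there x∈) (there y∈) x≢y  = allPairs-lookup R-sym rxs x∈ y∈ x≢y

AllTriples : (A → A → A → Set) → List A → Set
AllTriples R []       = ⊤
AllTriples R (x ∷ xs) = AllPairs (R x) xs × AllTriples R xs

module _ {R : A → A → A → Set}
         (swap₁₂ : ∀ {x y z} → R x y z → R y x z)
         (swap₂₃ : ∀ {x y z} → R x y z → R x z y) where

  allTriples-lookup : AllTriples R xs → x ∈ xs → y ∈ xs → z ∈ xs →
                      x ≢ y → x ≢ z → y ≢ z → R x y z
  allTriples-lookup _         (here refl) (here refl) _           x≢y _   _   = ⊥-elim (x≢y refl)
  allTriples-lookup _         (here refl) _           (here refl) _   x≢z _   = ⊥-elim (x≢z refl)
  allTriples-lookup _         _           (here refl) (here refl) _   _   y≢z = ⊥-elim (y≢z refl)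
  allTriples-lookup (rx , _)  (here refl) (there y∈)  (there z∈)  _   _   y≢z =
    allPairs-lookup swap₂₃ rx y∈ z∈ y≢z
  allTriples-lookup (ry , _)  (there x∈)  (here refl) (there z∈)  _   x≢z _   =
    swap₁₂ (allPairs-lookup swap₂₃ ry x∈ z∈ x≢z)
  allTriples-lookup (rz , _)  (there x∈)  (there y∈)  (here refl) x≢y _   _   =
    swap₂₃ (swap₁₂ (allPairs-lookup swap₂₃ rz x∈ y∈ x≢y))
  allTriples-lookup (_ , rxs) (there x∈)  (there y∈)  (there z∈)  x≢y x≢z y≢z =
    allTriples-lookup rxs x∈ y∈ z∈ x≢y x≢z y≢z

pairs : List A → List (A × A)
pairs []       = []
pairs (x ∷ xs) = map (x ,_) xs ++ pairs xs

length-pairs : (xs : List A) → length (pairs xs) ≡ length xs C 2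
length-pairs []       = refl
length-pairs (x ∷ xs) = begin
  length (map (x ,_) xs ++ pairs xs)         ≡⟨ length-++ (map (x ,_) xs) ⟩
  length (map (x ,_) xs) + length (pairs xs) ≡⟨ cong₂ _+_ (length-map (x ,_) xs) (length-pairs xs) ⟩
  length xs + length xs C 2                  ≡⟨ cong (_+ length xs C 2) (nC1≡n (length xs)) ⟨
  length xs C 1 + length xs C 2              ≡⟨ nCk+nC[k+1]≡[n+1]C[k+1] (length xs) 1 ⟩
  suc (length xs) C 2                        ∎
  where open ≡-Reasoning

∈-pairs⁻ : (xs : List A) → (x , y) ∈ pairs xs → x ∈ xs × y ∈ xs
∈-pairs⁻ (w ∷ ws) xy∈ with ∈-++⁻ (map (w ,_) ws) xy∈
... | inj₁ xy∈head with ∈-map⁻ (w ,_) xy∈head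
...   | _ , y∈ , refl = here refl , there y∈
∈-pairs⁻ (w ∷ ws) xy∈ | inj₂ xy∈tail =
  let x∈ , y∈ = ∈-pairs⁻ ws xy∈tail in there x∈ , there y∈

allPairs-pairs : {R : A → A → Set} → AllPairs R xs → (x , y) ∈ pairs xs → R x y
allPairs-pairs {xs = w ∷ ws} (rw ∷ rws) xy∈ with ∈-++⁻ (map (w ,_) ws) xy∈
... | inj₁ xy∈head with ∈-map⁻ (w ,_) xy∈head
...   | _ , y∈ , refl = All.lookup rw y∈
allPairs-pairs {xs = w ∷ ws} (rw ∷ rws) xy∈ | inj₂ xy∈tail = allPairs-pairs rws xy∈tail

fromMaybe-findᵇ : (p : A → Bool) (a : A) (xs : List A) → Any (T ∘ p) xs →
                  fromMaybe a (findᵇ p xs) ∈ xs × T (p (fromMaybe a (findᵇ p xs)))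
fromMaybe-findᵇ p a (x ∷ xs) px∈ with p x in px≡
... | true = here refl , subst T (sym px≡) _
fromMaybe-findᵇ p a (x ∷ xs) (here px)  | false = ⊥-elim (subst T px≡ px)
fromMaybe-findᵇ p a (x ∷ xs) (there px∈) | false =
  let x∈ , px = fromMaybe-findᵇ p a xs px∈ in there x∈ , px

decode : (A → ℕ) → A → List A → ℕ → A
decode ι a₀ []       i = a₀
decode ι a₀ (a ∷ as) i with ι a ≟ i
... | yes _ = a
... | no  _ = decode ι a₀ as i

decode-ι : ∀ (ι : A → ℕ) a₀ {as a} → Unique (map ι as) → a ∈ as → decode ι a₀ as (ι a) ≡ a
decode-ι ι a₀ {b ∷ bs} {a} (ιb∉ ∷ u) a∈ with ι b ≟ ι a | a∈
... | yes _       | here refl  = refl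
... | yes ιb≡ιa   | there a∈bs = ⊥-elim (All.lookup ιb∉ (∈-map⁺ ι a∈bs) ιb≡ιa)
... | no  ιb≢ιa   | here refl  = ⊥-elim (ιb≢ιa refl)
... | no  _       | there a∈bs = decode-ι ι a₀ u a∈bs

sum-bound : ∀ {n} q (c : B → ℕ) (ws : List B) → All (λ w → n ≤ q * c w) ws →
            length ws * n ≤ q * sum (map c ws)
sum-bound q c []       []       = z≤n
sum-bound {n = n} q c (w ∷ ws) (h ∷ hs) = begin
  n + length ws * n            ≤⟨ +-mono-≤ h (sum-bound q c ws hs) ⟩
  q * c w + q * sum (map c ws) ≡⟨ *-distribˡ-+ q (c w) (sum (map c ws)) ⟨
  q * sum (map c (w ∷ ws))     ∎
  where open ≤-Reasoning

module _ (F : B → A → Bool) (zs : List A) where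

  Collision : List B → Set
  Collision ws = ∃[ w ] ∃[ w' ] (w , w') ∈ pairs ws × ∃[ z ] z ∈ zs × T (F w z) × T (F w' z)

  covered : List B → A → Bool
  covered ws z = any (λ w → F w z) ws

  collision-or-additive : ∀ ws → Collision ws ⊎ sum (map (λ w → count (F w) zs) ws) ≡ count (covered ws) zs
  collision-or-additive []       = inj₂ (sym (count-false zs))
    where
    count-false : ∀ zs → count (λ _ → false) zs ≡ 0
    count-false []       = refl
    count-false (_ ∷ zs) = count-false zs
  collision-or-additive (w ∷ ws) with collision-or-additive ws
  ... | inj₁ (u , u' , uu'∈ , rest) = inj₁ (u , u' , ∈-++⁺ʳ (map (w ,_) ws) uu'∈ , rest)
  ... | inj₂ additive with any? (λ z → T? (F w z ∧ covered ws z)) zs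
  ...   | no disjoint = inj₂ (begin
          count (F w) zs + sum (map (λ w → count (F w) zs) ws) ≡⟨ cong (count (F w) zs +_) additive ⟩
          count (F w) zs + count (covered ws) zs                ≡⟨ count-∨ (F w) (covered ws) zs disjoint ⟨
          count (covered (w ∷ ws)) zs                           ∎)
    where open ≡-Reasoning
  ...   | yes shared =
    let z , z∈ , Fwz∧cov = find shared
        Fwz , cov = Equivalence.to T-∧ Fwz∧cov
        w' , w'∈ , Fw'z = find (any⁻ (λ w → F w z) ws cov)
    in inj₁ (w , w' , ∈-++⁺ˡ (∈-map⁺ (w ,_) w'∈) , z , z∈ , Fwz , Fw'z)

  collision : ∀ ws q → 0 < length zs → q < length ws →
              All (λ w → length zs ≤ q * count (F w) zs) ws → Collision ws
  collision ws q zs≢[] q<ws dense with collision-or-additive ws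
  ... | inj₁ c = c
  ... | inj₂ additive = ⊥-elim (<⇒≱ q<ws ws≤q)
    where
    n : ℕ
    n = length zs
    ws≤q : length ws ≤ q
    ws≤q = *-cancelʳ-≤ (length ws) q n ⦃ >-nonZero zs≢[] ⦄ (begin
      length ws * n                          ≤⟨ sum-bound q (λ w → count (F w) zs) ws dense ⟩
      q * sum (map (λ w → count (F w) zs) ws) ≡⟨ cong (q *_) additive ⟩
      q * count (covered ws) zs              ≤⟨ *-monoʳ-≤ q (length-filter _ zs) ⟩
      q * n                                  ∎)
      where open ≤-Reasoning

module _ {C : Set} (_≟ᶜ_ : DecidableEquality C) where

  pigeonhole : ∀ {A : Set} {b : ℕ} (f : A → C) (cs : List C) (xs : List A) →
               All (λ x → f x ∈ cs) xs → length cs * b < length xs →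
               ∃[ γ ] γ ∈ cs × ∃[ ys ] ys ⊆ xs × All (λ y → f y ≡ γ) ys × b < length ys
  pigeonhole f []       (x ∷ _) (() ∷ _) _
  pigeonhole {A} {b} f (γ ∷ cs) xs fxs∈ big with b <? length (filter (λ x → f x ≟ᶜ γ) xs)
  ... | yes b<class = γ , here refl , _ , filter-⊆ _ xs , all-filter _ xs , b<class
  ... | no b≮class =
    let γ' , γ'∈ , ys , ys⊆ , fys , b<ys = pigeonhole f cs others others-coloured others-big
    in γ' , there γ'∈ , ys , ⊆-trans ys⊆ (filter-⊆ _ xs) , fys , b<ys
    where
    class others : List A
    class  = filter (λ x → f x ≟ᶜ γ) xs
    others = filter (∁? (λ x → f x ≟ᶜ γ)) xs
    others-coloured : All (λ x → f x ∈ cs) others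
    others-coloured = All.zipWith drop-γ (All.filter⁺ _ fxs∈ , all-filter _ xs)
      where
      drop-γ : ∀ {x} → f x ∈ γ ∷ cs × f x ≢ γ → f x ∈ cs
      drop-γ (here fx≡γ , fx≢γ) = ⊥-elim (fx≢γ fx≡γ)
      drop-γ (there fx∈ , _)    = fx∈
    others-big : length cs * b < length others
    others-big = +-cancelˡ-< b _ _ (begin-strict
      b + length cs * b            <⟨ big ⟩
      length xs                    ≡⟨ length-filter-∁ _ xs ⟨
      length class + length others ≤⟨ +-monoˡ-≤ _ (≮⇒≥ b≮class) ⟩
      b + length others            ∎)
      where open ≤-Reasoning

ramseyBound : ℕ → ℕ → ℕ
ramseyBound c zero    = 0
ramseyBound c (suc t) = suc (c * ramseyBound c t)

module Ramsey {A C : Set} (_≟ᶜ_ : DecidableEquality C) (colour : A → A → C) (cs : List C) where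

  Coloured : List A → Set
  Coloured xs = ∀ {x y} → x ∈ xs → y ∈ xs → x ≢ y → colour x y ∈ cs

  Coloured-resp-⊆ : ∀ {xs ys} → xs ⊆ ys → Coloured ys → Coloured xs
  Coloured-resp-⊆ τ col x∈ y∈ = col (Any-resp-⊆ τ x∈) (Any-resp-⊆ τ y∈)

  -- Every vertex sees all later vertices of the chain in one colour, recorded next to it.
  Chain : List (A × C) → Set
  Chain = AllPairs (λ (x , γ) (y , _) → colour x y ≡ γ)

  chain : ∀ t xs → Unique xs → Coloured xs → ramseyBound (length cs) t < length xs →
          ∃[ ps ] length ps ≡ t × map proj₁ ps ⊆ xs × All (λ p → proj₂ p ∈ cs) ps × Chain ps
  chain zero    xs       _          _   _   = [] , refl , minimum xs , [] , []
  chain (suc t) (x ∷ xs) (x∉xs ∷ u) col big =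
    let γ , γ∈ , ys , ys⊆xs , x-γ-ys , ys-big = pigeonhole _≟ᶜ_ (colour x) cs xs x-coloured (≤-pred big)
        ps , len , ps⊆ys , ps-colours , ps-chain =
          chain t ys (AllPairs-resp-⊆ ys⊆xs u) (Coloured-resp-⊆ (_ ∷ʳ ys⊆xs) col) ys-big
    in (x , γ) ∷ ps , cong suc len , refl ∷ ⊆-trans ps⊆ys ys⊆xs , γ∈ ∷ ps-colours ,
       All.map⁻ (All-resp-⊆ ps⊆ys x-γ-ys) ∷ ps-chain
    where
    x-coloured : All (λ y → colour x y ∈ cs) xs
    x-coloured = All.tabulate λ y∈ → col (here refl) (there y∈) (All.lookup x∉xs y∈)

  ramsey : ∀ s xs → Unique xs → Coloured xs → ramseyBound (length cs) (suc (length cs * s)) < length xs →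
           ∃[ γ ] γ ∈ cs × ∃[ ys ] ys ⊆ xs × s < length ys × AllPairs (λ x y → colour x y ≡ γ) ys
  ramsey s xs u col big =
    let ps , len , ps⊆xs , ps-colours , ps-chain = chain _ xs u col big
        γ , γ∈ , qs , qs⊆ps , qs-γ , s<qs =
          pigeonhole _≟ᶜ_ proj₂ cs ps ps-colours (subst (length cs * s <_) (sym len) (n<1+n _))
    in γ , γ∈ , map proj₁ qs , ⊆-trans (Sublist.map⁺ proj₁ qs⊆ps) ps⊆xs ,
       subst (s <_) (sym (length-map proj₁ qs)) s<qs ,
       AllPairs.map⁺ (monochromatic qs-γ (AllPairs-resp-⊆ qs⊆ps ps-chain))
    where
    monochromatic : ∀ {γ qs} → All (λ q → proj₂ q ≡ γ) qs → Chain qs →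
                    AllPairs (λ q q' → colour (proj₁ q) (proj₁ q') ≡ γ) qs
    monochromatic []           []             = []
    monochromatic (q-γ ∷ qs-γ) (q-row ∷ rows) = All.map (λ c → trans c q-γ) q-row ∷ monochromatic qs-γ rows

δ*n≤m⇒n≤↧δ*m : ∀ δ → Positive δ → ∀ n m → δ ℚ.* (ℤ.+ n ℚ./ 1) ℚ.≤ ℤ.+ m ℚ./ 1 → n ≤ ↧ₙ δ * m
δ*n≤m⇒n≤↧δ*m δ@(mkℚ (ℤ.+ suc p) d-1 _) _ n m δn≤m = begin
  n             ≤⟨ m≤m*n n (suc p) ⟩
  n * suc p     ≡⟨ *-comm n (suc p) ⟩
  suc p * n     ≤⟨ ℤ.drop‿+≤+ (subst₂ ℤ._≤_ numerators denominators cross) ⟩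
  m * suc d-1   ≡⟨ *-comm m (suc d-1) ⟩
  suc d-1 * m   ∎
  where
  open ≤-Reasoning
  cross : (ℤ.+ suc p ℤ.* ℤ.+ n) ℤ.* ℤ.+ 1 ℤ.≤ ℤ.+ m ℤ.* ℤ.+ (suc d-1 * 1)
  cross with ℚᵘ.≤-respʳ-≃ (ℚ.toℚᵘ-fromℚᵘ (mkℚᵘ (ℤ.+ m) 0))
               (ℚᵘ.≤-respˡ-≃ (ℚᵘ.≃-trans (ℚ.toℚᵘ-homo-* δ (ℤ.+ n ℚ./ 1))
                                          (ℚᵘ.*-congˡ {toℚᵘ δ} (ℚ.toℚᵘ-fromℚᵘ (mkℚᵘ (ℤ.+ n) 0))))
                 (ℚ.toℚᵘ-mono-≤ δn≤m))
  ... | *≤* δn≤m-cross = δn≤m-cross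
  numerators : (ℤ.+ suc p ℤ.* ℤ.+ n) ℤ.* ℤ.+ 1 ≡ ℤ.+ (suc p * n)
  numerators = trans (ℤ.*-identityʳ _) (sym (ℤ.pos-* (suc p) n))
  denominators : ℤ.+ m ℤ.* ℤ.+ (suc d-1 * 1) ≡ ℤ.+ (m * suc d-1)
  denominators = trans (cong (λ d → ℤ.+ m ℤ.* ℤ.+ d) (*-identityʳ (suc d-1))) (sym (ℤ.pos-* m (suc d-1)))

module _ (𝒜 : ReducedHypergraph) where
  open ReducedHypergraph 𝒜

  edge-rotate : ∀ {x y z} → edge x y z ≡ true → edge z x y ≡ true
  edge-rotate {x} {y} {z} e = trans (sym (trans (edge-sym₂ x y z) (edge-sym₁ x z y))) e

  supportsK5-fromLabelling :
    {Lab : Set} (labs : List Lab) (ι : Lab → ℕ) (t : Lab → Lab → ℕ) →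
    length labs ≡ 5 → Unique (map ι labs) → All (λ a → ι a ∈ I) labs →
    (∀ a b → t a b ≡ t b a) →
    AllPairs (λ a b → t a b ∈ P (ι a) (ι b)) labs →
    AllTriples (λ a b c → edge (t a b) (t a c) (t b c) ≡ true) labs →
    SupportsK5 𝒜
  supportsK5-fromLabelling labs@(a₀ ∷ _) ι t five ι-unique ι∈I t-sym t∈P t-edges =
    J , (ι-unique , All.map⁺ ι∈I) , trans (length-map ι labs) five ,
    Pc , (λ i j _ _ _ → t-sym _ _) , Pc∈P , Pc-edge
    where
    J : List ℕ
    J = map ι labs
    Pc : ℕ → ℕ → ℕ
    Pc i j = t (decode ι a₀ labs i) (decode ι a₀ labs j)
    label : ∀ {i} → i ∈ J → ∃[ a ] a ∈ labs × i ≡ ι a × decode ι a₀ labs i ≡ a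
    label i∈ with ∈-map⁻ ι i∈
    ... | a , a∈ , refl = a , a∈ , refl , decode-ι ι a₀ ι-unique a∈
    Pc∈P : ∀ i j → i ∈ J → j ∈ J → i ≢ j → Pc i j ∈ P i j
    Pc∈P i j i∈ j∈ i≢j with label i∈ | label j∈
    ... | a , a∈ , refl , da | b , b∈ , refl , db rewrite da | db =
      allPairs-lookup (λ {a} {b} → subst₂ _∈_ (t-sym a b) (P-sym (ι a) (ι b))) t∈P a∈ b∈ (i≢j ∘ cong ι)
    Pc-edge : ∀ i j k → i ∈ J → j ∈ J → k ∈ J → i ≢ j → i ≢ k → j ≢ k →
              edge (Pc i j) (Pc i k) (Pc j k) ≡ true
    Pc-edge i j k i∈ j∈ k∈ i≢j i≢k j≢k with label i∈ | label j∈ | label k∈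
    ... | a , a∈ , refl , da | b , b∈ , refl , db | c , c∈ , refl , dc rewrite da | db | dc =
      allTriples-lookup swap₁₂ swap₂₃ t-edges a∈ b∈ c∈ (i≢j ∘ cong ι) (i≢k ∘ cong ι) (j≢k ∘ cong ι)
      where
      swap₁₂ : ∀ {a b c} → edge (t a b) (t a c) (t b c) ≡ true → edge (t b a) (t b c) (t a c) ≡ true
      swap₁₂ {a} {b} {c} e = subst (λ x → edge x (t b c) (t a c) ≡ true) (t-sym a b)
                                   (trans (sym (edge-sym₂ (t a b) (t a c) (t b c))) e)
      swap₂₃ : ∀ {a b c} → edge (t a b) (t a c) (t b c) ≡ true → edge (t a c) (t a b) (t c b) ≡ true
      swap₂₃ {a} {b} {c} e = subst (λ x → edge (t a c) (t a b) x ≡ true) (t-sym b c)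
                                   (trans (sym (edge-sym₁ (t a b) (t a c) (t b c))) e)

module Construction
  (𝒜 : ReducedHypergraph) (δ : ℚ) (δ>0 : Positive δ) (K L M : List ℕ) (Q R S : ℕ → ℕ → ℕ)
  (K⊆I : SubsetOfI 𝒜 K) (L⊆I : SubsetOfI 𝒜 L) (M⊆I : SubsetOfI 𝒜 M)
  (K∩L : Disjoint 𝒜 K L) (K∩M : Disjoint 𝒜 K M) (L∩M : Disjoint 𝒜 L M)
  (Q-transversal : IsTransversal 𝒜 K L Q) (R-transversal : IsTransversal 𝒜 K M R)
  (S-transversal : IsTransversal 𝒜 L M S) (inhabited : Inhabited 𝒜 K L M Q R S)
  (QR-links : IntersectingLinks 𝒜 δ K L M Q R) (QS-links : IntersectingLinks 𝒜 δ L K M (λ ℓ k → Q k ℓ) S)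
  (m : ℕ) (m∈M : m ∈ M)
  where
  open ReducedHypergraph 𝒜

  d : ℕ
  d = ↧ₙ δ

  linkᴷ : ℕ → ℕ → ℕ → ℕ → Bool
  linkᴷ k k' ℓ z = edge (Q k ℓ) (Q k' ℓ) z ∧ edge (R k m) (R k' m) z

  linkᴸ : ℕ → ℕ → ℕ → ℕ → Bool
  linkᴸ ℓ ℓ' k z = edge (Q k ℓ) (Q k ℓ') z ∧ edge (S ℓ m) (S ℓ' m) z

  dense-linkᴷ : ∀ {ℓ k k'} → ℓ ∈ L → k ∈ K → k' ∈ K → k ≢ k' →
                length (P k k') ≤ d * count (linkᴷ k k' ℓ) (P k k')
  dense-linkᴷ ℓ∈ k∈ k'∈ k≢k' = δ*n≤m⇒n≤↧δ*m δ δ>0 _ _ (QR-links _ m _ _ ℓ∈ m∈M k∈ k'∈ k≢k')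

  dense-linkᴸ : ∀ {k ℓ ℓ'} → k ∈ K → ℓ ∈ L → ℓ' ∈ L → ℓ ≢ ℓ' →
                length (P ℓ ℓ') ≤ d * count (linkᴸ ℓ ℓ' k) (P ℓ ℓ')
  dense-linkᴸ k∈ ℓ∈ ℓ'∈ ℓ≢ℓ' = δ*n≤m⇒n≤↧δ*m δ δ>0 _ _ (QS-links _ m _ _ k∈ m∈M ℓ∈ ℓ'∈ ℓ≢ℓ')

  0<|P| : ∀ {i j} → i ∈ I → j ∈ I → i ≢ j → 0 < length (P i j)
  0<|P| i∈ j∈ i≢j = ≢[]⇒0<length (P-nonempty _ _ i∈ j∈ i≢j)

  K-in-I : ∀ {k} → k ∈ K → k ∈ I
  K-in-I = All.lookup (proj₂ K⊆I)

  L-in-I : ∀ {ℓ} → ℓ ∈ L → ℓ ∈ I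
  L-in-I = All.lookup (proj₂ L⊆I)

  apart : ∀ {X Y x y} → Disjoint 𝒜 X Y → x ∈ X → y ∈ Y → x ≢ y
  apart X∩Y x∈ y∈ refl = X∩Y _ x∈ y∈

  -- Labels 0, 1, 2, 3, 4 stand for k, k', ℓ, ℓ', m; upper a b is the vertex on the pair a < b.
  supportsK5-at : ∀ {k k' ℓ ℓ' X Y} → k ∈ K → k' ∈ K → k ≢ k' → ℓ ∈ L → ℓ' ∈ L → ℓ ≢ ℓ' →
    X ∈ P k k' → T (linkᴷ k k' ℓ X) → T (linkᴷ k k' ℓ' X) →
    Y ∈ P ℓ ℓ' → T (linkᴸ ℓ ℓ' k Y) → T (linkᴸ ℓ ℓ' k' Y) → SupportsK5 𝒜
  supportsK5-at {k} {k'} {ℓ} {ℓ'} {X} {Y} k∈ k'∈ k≢k' ℓ∈ ℓ'∈ ℓ≢ℓ' X∈ Xℓ Xℓ' Y∈ Yk Yk' =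
    supportsK5-fromLabelling 𝒜 labels index vertex refl distinct in-I vertex-sym in-P triangles
    where
    labels : List ℕ
    labels = 0 ∷ 1 ∷ 2 ∷ 3 ∷ 4 ∷ []

    index : ℕ → ℕ
    index 0 = k
    index 1 = k'
    index 2 = ℓ
    index 3 = ℓ'
    index _ = m

    upper : ℕ → ℕ → ℕ
    upper 0 1 = X
    upper 0 2 = Q k ℓ
    upper 0 3 = Q k ℓ'
    upper 0 4 = R k m
    upper 1 2 = Q k' ℓ
    upper 1 3 = Q k' ℓ'
    upper 1 4 = R k' m
    upper 2 3 = Y
    upper 2 4 = S ℓ m
    upper 3 4 = S ℓ' m
    upper _ _ = X

    vertex : ℕ → ℕ → ℕ
    vertex a b = upper (a ⊓ b) (a ⊔ b)

    vertex-sym : ∀ a b → vertex a b ≡ vertex b a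
    vertex-sym a b = cong₂ upper (⊓-comm a b) (⊔-comm a b)

    distinct : Unique (map index labels)
    distinct = (k≢k' ∷ apart K∩L k∈ ℓ∈ ∷ apart K∩L k∈ ℓ'∈ ∷ apart K∩M k∈ m∈M ∷ [])
             ∷ (apart K∩L k'∈ ℓ∈ ∷ apart K∩L k'∈ ℓ'∈ ∷ apart K∩M k'∈ m∈M ∷ [])
             ∷ (ℓ≢ℓ' ∷ apart L∩M ℓ∈ m∈M ∷ [])
             ∷ (apart L∩M ℓ'∈ m∈M ∷ [])
             ∷ [] ∷ []

    in-I : All (λ a → index a ∈ I) labels
    in-I = K-in-I k∈ ∷ K-in-I k'∈ ∷ L-in-I ℓ∈ ∷ L-in-I ℓ'∈ ∷ All.lookup (proj₂ M⊆I) m∈M ∷ []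

    in-P : AllPairs (λ a b → vertex a b ∈ P (index a) (index b)) labels
    in-P = (X∈ ∷ Q-transversal _ _ k∈ ℓ∈ ∷ Q-transversal _ _ k∈ ℓ'∈ ∷ R-transversal _ _ k∈ m∈M ∷ [])
         ∷ (Q-transversal _ _ k'∈ ℓ∈ ∷ Q-transversal _ _ k'∈ ℓ'∈ ∷ R-transversal _ _ k'∈ m∈M ∷ [])
         ∷ (Y∈ ∷ S-transversal _ _ ℓ∈ m∈M ∷ [])
         ∷ (S-transversal _ _ ℓ'∈ m∈M ∷ [])
         ∷ [] ∷ []

    triangles : AllTriples (λ a b c → edge (vertex a b) (vertex a c) (vertex b c) ≡ true) labels
    triangles =
      ( (edge-rotate 𝒜 (proj₁ (T-∧⇒≡true Xℓ)) ∷ edge-rotate 𝒜 (proj₁ (T-∧⇒≡true Xℓ'))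
                                              ∷ edge-rotate 𝒜 (proj₂ (T-∧⇒≡true Xℓ)) ∷ [])
      ∷ (proj₁ (T-∧⇒≡true Yk) ∷ inhabited _ _ _ k∈ ℓ∈ m∈M ∷ [])
      ∷ (inhabited _ _ _ k∈ ℓ'∈ m∈M ∷ [])
      ∷ [] ∷ [])
      , ( (proj₁ (T-∧⇒≡true Yk') ∷ inhabited _ _ _ k'∈ ℓ∈ m∈M ∷ [])
        ∷ (inhabited _ _ _ k'∈ ℓ'∈ m∈M ∷ [])
        ∷ [] ∷ [])
      , ((edge-rotate 𝒜 (proj₂ (T-∧⇒≡true Yk)) ∷ []) ∷ [] ∷ [])
      , ([] ∷ [])
      , []
      , tt

  module _ (K-big : suc d ≤ length K)
           (L-big : ramseyBound (suc d C 2) (suc ((suc d C 2) * d)) < length L) where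

    K' : List ℕ
    K' = take (suc d) K

    K'⊆K : K' ⊆ K
    K'⊆K = take-⊆ (suc d) K

    K'-in-K : ∀ {k} → k ∈ K' → k ∈ K
    K'-in-K = Any-resp-⊆ K'⊆K

    |K'| : length K' ≡ suc d
    |K'| = trans (length-take (suc d) K) (m≤n⇒m⊓n≡m K-big)

    meets : ℕ → ℕ → ℕ × ℕ → Bool
    meets ℓ ℓ' (k , k') = any (λ z → linkᴸ ℓ ℓ' k z ∧ linkᴸ ℓ ℓ' k' z) (P ℓ ℓ')

    -- The default (0 , 0) is junk: colour-meets shows a meeting pair exists for distinct ℓ, ℓ' ∈ L.
    colour : ℕ → ℕ → ℕ × ℕ
    colour ℓ ℓ' = fromMaybe (0 , 0) (findᵇ (meets ℓ ℓ') (pairs K'))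

    colour-meets : ∀ {ℓ ℓ'} → ℓ ∈ L → ℓ' ∈ L → ℓ ≢ ℓ' →
                   colour ℓ ℓ' ∈ pairs K' × T (meets ℓ ℓ' (colour ℓ ℓ'))
    colour-meets {ℓ} {ℓ'} ℓ∈ ℓ'∈ ℓ≢ℓ' =
      let k , k' , kk'∈ , z , z∈ , zk , zk' =
            collision (linkᴸ ℓ ℓ') (P ℓ ℓ') K' d (0<|P| (L-in-I ℓ∈) (L-in-I ℓ'∈) ℓ≢ℓ')
              (subst (d <_) (sym |K'|) (n<1+n d))
              (All.tabulate λ k∈ → dense-linkᴸ (K'-in-K k∈) ℓ∈ ℓ'∈ ℓ≢ℓ')
      in fromMaybe-findᵇ (meets ℓ ℓ') _ (pairs K')
           (lose kk'∈ (any⁺ _ (lose z∈ (Equivalence.from T-∧ (zk , zk')))))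

    colour-vertex : ∀ {ℓ ℓ' k k'} → ℓ ∈ L → ℓ' ∈ L → ℓ ≢ ℓ' → colour ℓ ℓ' ≡ (k , k') →
                    ∃[ Y ] Y ∈ P ℓ ℓ' × T (linkᴸ ℓ ℓ' k Y) × T (linkᴸ ℓ ℓ' k' Y)
    colour-vertex {ℓ} {ℓ'} ℓ∈ ℓ'∈ ℓ≢ℓ' colour≡ =
      let Y , Y∈ , Ykk' = find (any⁻ _ _ (subst (T ∘ meets ℓ ℓ') colour≡ (proj₂ (colour-meets ℓ∈ ℓ'∈ ℓ≢ℓ'))))
      in Y , Y∈ , Equivalence.to T-∧ Ykk'

    monochromatic : ∃[ kk' ] kk' ∈ pairs K' ×
                    ∃[ W ] W ⊆ L × d < length W × AllPairs (λ ℓ ℓ' → colour ℓ ℓ' ≡ kk') W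
    monochromatic =
      Ramsey.ramsey (≡-dec _≟_ _≟_) colour (pairs K') d L (proj₁ L⊆I)
        (λ ℓ∈ ℓ'∈ ℓ≢ℓ' → proj₁ (colour-meets ℓ∈ ℓ'∈ ℓ≢ℓ'))
        (subst (λ c → ramseyBound c (suc (c * d)) < length L) (sym |pairs-K'|) L-big)
      where
      |pairs-K'| : length (pairs K') ≡ suc d C 2
      |pairs-K'| = trans (length-pairs K') (cong (_C 2) |K'|)

    supportsK5-from-collision : ∀ {k k' W ℓ ℓ' X} → k ∈ K → k' ∈ K → k ≢ k' → W ⊆ L →
                         AllPairs (λ ℓ ℓ' → colour ℓ ℓ' ≡ (k , k')) W → (ℓ , ℓ') ∈ pairs W →
                         X ∈ P k k' → T (linkᴷ k k' ℓ X) → T (linkᴷ k k' ℓ' X) → SupportsK5 𝒜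
    supportsK5-from-collision {W = W} {ℓ} {ℓ'} k∈ k'∈ k≢k' W⊆L W-mono ℓℓ'∈ X∈ Xℓ Xℓ' =
      let Y , Y∈ , Yk , Yk' = colour-vertex ℓ∈ ℓ'∈ ℓ≢ℓ' (allPairs-pairs W-mono ℓℓ'∈)
      in supportsK5-at k∈ k'∈ k≢k' ℓ∈ ℓ'∈ ℓ≢ℓ' X∈ Xℓ Xℓ' Y∈ Yk Yk'
      where
      ℓ∈ : ℓ ∈ L
      ℓ∈ = Any-resp-⊆ W⊆L (proj₁ (∈-pairs⁻ W ℓℓ'∈))
      ℓ'∈ : ℓ' ∈ L
      ℓ'∈ = Any-resp-⊆ W⊆L (proj₂ (∈-pairs⁻ W ℓℓ'∈))
      ℓ≢ℓ' : ℓ ≢ ℓ'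
      ℓ≢ℓ' = allPairs-pairs (AllPairs-resp-⊆ W⊆L (proj₁ L⊆I)) ℓℓ'∈

    supportsK5-from-monochromatic : ∀ {k k' W} → k ∈ K → k' ∈ K → k ≢ k' → W ⊆ L → d < length W →
                                    AllPairs (λ ℓ ℓ' → colour ℓ ℓ' ≡ (k , k')) W → SupportsK5 𝒜
    supportsK5-from-monochromatic {k} {k'} {W} k∈ k'∈ k≢k' W⊆L d<|W| W-mono =
      let ℓ , ℓ' , ℓℓ'∈ , X , X∈ , Xℓ , Xℓ' =
            collision (linkᴷ k k') (P k k') W d (0<|P| (K-in-I k∈) (K-in-I k'∈) k≢k') d<|W|
              (All.tabulate λ ℓ∈ → dense-linkᴷ (Any-resp-⊆ W⊆L ℓ∈) k∈ k'∈ k≢k')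
      in supportsK5-from-collision k∈ k'∈ k≢k' W⊆L W-mono ℓℓ'∈ X∈ Xℓ Xℓ'

    supportsK5 : SupportsK5 𝒜
    supportsK5 =
      let (k , k') , kk'∈ , _ , W⊆L , d<|W| , W-mono = monochromatic
      in supportsK5-from-monochromatic (K'-in-K (proj₁ (∈-pairs⁻ K' kk'∈))) (K'-in-K (proj₂ (∈-pairs⁻ K' kk'∈)))
        (allPairs-pairs (AllPairs-resp-⊆ K'⊆K (proj₁ K⊆I)) kk'∈) W⊆L d<|W| W-mono

-- K must supply d + 1 indices, and L enough indices for Ramsey with (d + 1) C 2 colours
-- to find d + 1 of them spanning a monochromatic clique.
threshold : ℕ → ℕ
threshold d = suc d + suc (ramseyBound (suc d C 2) (suc ((suc d C 2) * d)))

lemma4p6 : (δ : ℚ) → Positive δ → Σ ℕ λ n₀ →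
  (𝒜 : ReducedHypergraph) (K L M : List ℕ) →
  SubsetOfI 𝒜 K → SubsetOfI 𝒜 L → SubsetOfI 𝒜 M →
  Disjoint 𝒜 K L → Disjoint 𝒜 K M → Disjoint 𝒜 L M →
  n₀ ≤ length K → n₀ ≤ length L → n₀ ≤ length M →
  (Q R S : ℕ → ℕ → ℕ) →
  IsTransversal 𝒜 K L Q → IsTransversal 𝒜 K M R → IsTransversal 𝒜 L M S →
  Inhabited 𝒜 K L M Q R S →
  IntersectingLinks 𝒜 δ K L M Q R →
  IntersectingLinks 𝒜 δ L K M (λ ℓ k → Q k ℓ) S →
  SupportsK5 𝒜
lemma4p6 δ δ>0 = threshold d ,
  λ 𝒜 K L M K⊆I L⊆I M⊆I K∩L K∩M L∩M K-big L-big M-big Q R S Q-tr R-tr S-tr inh QR QS →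
    let m , m∈M = 0<length⇒∈ (<-≤-trans z<s M-big)
    in Construction.supportsK5 𝒜 δ δ>0 K L M Q R S K⊆I L⊆I M⊆I K∩L K∩M L∩M Q-tr R-tr S-tr inh QR QS
         m m∈M (≤-trans (m≤m+n (suc d) _) K-big) (<-≤-trans (m≤n+m _ (suc d)) L-big)
  where
  d : ℕ
  d = ↧ₙ δ
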